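{- Let $p$ be a prime, $n \geq 1$, $k \in \mathbb{Z}_{\geq 1}$, and $A_k := \mathrm{M}_n(\mathbb{Z}/p^k\mathbb{Z})$. Fix $M(t), N(t) \in A_k[t]$. For any $X \in A_k$ there exist unique $U(t) \in A_k[t]$ and unique $X' \in A_k$ such that \[\big(X + I_n t + p I_n t^2 M(t)\big)\, U(t) = X' + I_n t + p I_n t^2 N(t).\] Moreover, $U(t) \in I_n + pA_k[t]$ and $X' \equiv X \pmod p$.
   Context: $A_k[t]$ is the polynomial ring over the (noncommutative) ring $A_k$ in a variable $t$ commuting with $A_k$. -}

module Defs where

open import Data.Nat as ℕ using (ℕ; zero; suc; _∸_)
open import Data.Integer as ℤ using (ℤ; +_; _-_; _+_; _*_)
open import Data.Fin using (Fin) renaming (zero to fzero; suc to fsuc)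
open import Data.List using (List; []; _∷_; map)
open import Data.Product using (∃)
open import Relation.Binary.PropositionalEquality using (_≡_)
open import Relation.Nullary using (Dec; yes; no)
open import Data.Fin using (_≟_)

_≡_[mod_] : ℤ → ℤ → ℕ → Set
a ≡ b [mod m ] = ∃ λ (q : ℤ) → a - b ≡ q * (+ m)

-- n×n matrices with integer entries; an element of M_n(ℤ/p^k ℤ) is represented
-- by any integer lift, and equality in M_n(ℤ/p^kℤ) is entrywise congruence mod p^k.
Mat : ℕ → Set
Mat n = Fin n → Fin n → ℤ

_≈M_[mod_] : ∀ {n} → Mat n → Mat n → ℕ → Set
A ≈M B [mod m ] = ∀ i j → A i j ≡ B i j [mod m ]

0M : ∀ {n} → Mat n
0M i j = + 0

IM : ∀ {n} → Mat n
IM i j with i ≟ j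
... | yes _ = + 1
... | no  _ = + 0

_+M_ : ∀ {n} → Mat n → Mat n → Mat n
(A +M B) i j = A i j + B i j

sumM : ∀ {n} → ℕ → (ℕ → Mat n) → Mat n
sumM zero    f = 0M
sumM (suc m) f = sumM m f +M f m

sumℤ : ∀ {n} → (Fin n → ℤ) → ℤ
sumℤ {zero}  f = + 0
sumℤ {suc n} f = f fzero + sumℤ (λ i → f (fsuc i))

_*M_ : ∀ {n} → Mat n → Mat n → Mat n
(A *M B) i j = sumℤ (λ l → A i l * B l j)

_·M_ : ∀ {n} → ℤ → Mat n → Mat n
(c ·M A) i j = c * A i j

-- Polynomials in t over M_n(−) (t central), as lists of coefficients
-- [a₀, a₁, …] meaning a₀ + a₁ t + ….
Poly : ℕ → Set
Poly n = List (Mat n)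

coeff : ∀ {n} → Poly n → ℕ → Mat n
coeff []       i       = 0M
coeff (a ∷ as) zero    = a
coeff (a ∷ as) (suc i) = coeff as i

mulCoeff : ∀ {n} → Poly n → Poly n → ℕ → Mat n
mulCoeff P Q i = sumM (suc i) (λ j → coeff P j *M coeff Q (i ∸ j))

_≈P_[mod_] : ∀ {n} → Poly n → Poly n → ℕ → Set
P ≈P Q [mod m ] = ∀ i → coeff P i ≈M coeff Q i [mod m ]

shape : ∀ {n} → ℕ → Mat n → Poly n → Poly n
shape p X M = X ∷ IM ∷ map (λ c → (+ p) ·M c) M

ProdEq : ∀ {n} → ℕ → Poly n → Poly n → Poly n → Set
ProdEq m L U R = ∀ i → mulCoeff L U i ≈M coeff R i [mod m ]

-- Write L = X + t + p t² M.  The equation L U = X′ + t + p t² N reads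
-- (X + t) U = X′ + t + p t² (N − M U), and X + t is monic, so U can be taken to be the quotient
-- and −X′ the remainder of t + p t² (N − M U) on division by X + t.  Because of the factor p,
-- U ↦ quotient is a contraction for the p-adic filtration: iterating it k + 1 times from 0 gives a
-- solution mod p^k.  Modulo p the dividend is just t = (X + t)·1 − X, whence U ≡ 1 and X′ ≡ X.
-- Uniqueness is the same contraction: if two solutions agree mod p^s, their p t² M terms agree
-- mod p^(s+1), and multiplication by X + t is injective on polynomials.

module Submission where

open import Defs
open import Data.Nat using (ℕ; _≥_; _^_; suc)
open import Data.Nat.Primality using (Prime)
open import Data.Product using (Σ; _×_)

open import Data.Nat as ℕ using (zero; _∸_; _≤_; z≤n; s≤s)
import Data.Nat.Properties as ℕ
import Data.Nat.Divisibility as ℕ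
open import Data.Integer using (ℤ; +_; -_; _+_; _*_; _-_)
import Data.Integer.Properties as ℤ
open import Data.Integer.Divisibility.Signed
  using (_∣_; divides; ∣ᵤ⇒∣; ∣-trans; ∣m∣n⇒∣m+n; ∣m⇒∣-m; ∣m⇒∣m*n; ∣n⇒∣m*n; *-monoʳ-∣)
open import Data.Integer.Tactic.RingSolver using (solve-∀)
open import Data.Fin using (Fin) renaming (zero to fzero; suc to fsuc)
import Data.Fin as Fin
open import Data.List using ([]; _∷_; map; length)
open import Data.Product using (_,_; proj₁; proj₂)
open import Function using (_∘_)
open import Level using (0ℓ)
open import Relation.Binary.Bundles using (Setoid)
open import Relation.Binary.PropositionalEquality
  using (_≡_; refl; sym; trans; cong; subst; subst₂)
open import Relation.Nullary using (yes; no)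

private variable
  n m : ℕ

-- Congruences

-- Defs' congruences are ∃-types from which Agda cannot infer the two sides;
-- these records index them, so that congruence lemmas compose without annotations.
record _≡_⟨mod_⟩ (a b : ℤ) (m : ℕ) : Set where
  constructor mod-divides
  field difference : + m ∣ a - b

infix 4 _≡_⟨mod_⟩

mod-reflexive : ∀ {a b} → a ≡ b → a ≡ b ⟨mod m ⟩
mod-reflexive {a = a} refl = mod-divides (divides (+ 0) (ℤ.+-inverseʳ a))

mod-refl : ∀ {a} → a ≡ a ⟨mod m ⟩
mod-refl = mod-reflexive refl

mod-sym : ∀ {a b} → a ≡ b ⟨mod m ⟩ → b ≡ a ⟨mod m ⟩
mod-sym {a = a} {b} (mod-divides e) = mod-divides (subst (_ ∣_) (flip a b) (∣m⇒∣-m e))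
  where
  flip : ∀ a b → - (a - b) ≡ b - a
  flip = solve-∀

mod-trans : ∀ {a b c} → a ≡ b ⟨mod m ⟩ → b ≡ c ⟨mod m ⟩ → a ≡ c ⟨mod m ⟩
mod-trans {a = a} {b} {c} (mod-divides e) (mod-divides f) =
  mod-divides (subst (_ ∣_) (telescope a b c) (∣m∣n⇒∣m+n e f))
  where
  telescope : ∀ a b c → (a - b) + (b - c) ≡ a - c
  telescope = solve-∀

mod-+ : ∀ {a b c d} → a ≡ b ⟨mod m ⟩ → c ≡ d ⟨mod m ⟩ → a + c ≡ b + d ⟨mod m ⟩
mod-+ {a = a} {b} {c} {d} (mod-divides e) (mod-divides f) =
  mod-divides (subst (_ ∣_) (regroup a b c d) (∣m∣n⇒∣m+n e f))
  where
  regroup : ∀ a b c d → (a - b) + (c - d) ≡ (a + c) - (b + d)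
  regroup = solve-∀

mod-neg : ∀ {a b} → a ≡ b ⟨mod m ⟩ → - a ≡ - b ⟨mod m ⟩
mod-neg {a = a} {b} (mod-divides e) = mod-divides (subst (_ ∣_) (negate a b) (∣m⇒∣-m e))
  where
  negate : ∀ a b → - (a - b) ≡ - a - - b
  negate = solve-∀

mod-* : ∀ {a b c d} → a ≡ b ⟨mod m ⟩ → c ≡ d ⟨mod m ⟩ → a * c ≡ b * d ⟨mod m ⟩
mod-* {a = a} {b} {c} {d} (mod-divides e) (mod-divides f) =
  mod-divides (subst (_ ∣_) (expand a b c d) (∣m∣n⇒∣m+n (∣m⇒∣m*n c e) (∣n⇒∣m*n b f)))
  where
  expand : ∀ a b c d → (a - b) * c + b * (c - d) ≡ a * c - b * d
  expand = solve-∀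

mod-scale : ∀ c {a b} → a ≡ b ⟨mod m ⟩ → + c * a ≡ + c * b ⟨mod c ℕ.* m ⟩
mod-scale {m = m} c {a} {b} (mod-divides e) =
  mod-divides (subst₂ _∣_ (sym (ℤ.pos-* c m)) (factor (+ c) a b) (*-monoʳ-∣ (+ c) e))
  where
  factor : ∀ c a b → c * (a - b) ≡ c * a - c * b
  factor = solve-∀

mod-multiple : ∀ c a → + c * a ≡ + 0 ⟨mod c ⟩
mod-multiple c a = mod-divides (divides a (trans (ℤ.+-identityʳ (+ c * a)) (ℤ.*-comm (+ c) a)))

mod-weaken : ∀ {d a b} → d ℕ.∣ m → a ≡ b ⟨mod m ⟩ → a ≡ b ⟨mod d ⟩
mod-weaken d∣m (mod-divides e) = mod-divides (∣-trans (∣ᵤ⇒∣ d∣m) e)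

mod-one : ∀ {a b} → a ≡ b ⟨mod 1 ⟩
mod-one = mod-divides (∣ᵤ⇒∣ (ℕ.1∣ _))

^-monoʳ-∣ : ∀ p {s k} → s ≤ k → p ^ s ℕ.∣ p ^ k
^-monoʳ-∣ p z≤n       = ℕ.1∣ _
^-monoʳ-∣ p (s≤s s≤k) = ℕ.*-monoʳ-∣ p (^-monoʳ-∣ p s≤k)

sumℤ-cong : ∀ {f g : Fin n → ℤ} → (∀ l → f l ≡ g l ⟨mod m ⟩) → sumℤ f ≡ sumℤ g ⟨mod m ⟩
sumℤ-cong {zero}  e = mod-refl
sumℤ-cong {suc n} e = mod-+ (e fzero) (sumℤ-cong (e ∘ fsuc))

sumℤ-zero : ∀ n → sumℤ {n} (λ _ → + 0) ≡ + 0
sumℤ-zero zero    = refl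
sumℤ-zero (suc n) = trans (ℤ.+-identityˡ _) (sumℤ-zero n)

sumℤ-*-distribˡ : ∀ c (f : Fin n → ℤ) → sumℤ (λ l → c * f l) ≡ c * sumℤ f
sumℤ-*-distribˡ {zero}  c f = sym (ℤ.*-zeroʳ c)
sumℤ-*-distribˡ {suc n} c f = trans (cong (_+_ (c * f fzero)) (sumℤ-*-distribˡ c (f ∘ fsuc)))
  (sym (ℤ.*-distribˡ-+ c (f fzero) (sumℤ (f ∘ fsuc))))

IM-suc : ∀ (i j : Fin n) → IM {suc n} (fsuc i) (fsuc j) ≡ IM i j
IM-suc i j with i Fin.≟ j
... | yes _ = refl
... | no  _ = refl

IM-sym : ∀ (i j : Fin n) → IM i j ≡ IM j i
IM-sym fzero    fzero    = refl
IM-sym fzero    (fsuc j) = refl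
IM-sym (fsuc i) fzero    = refl
IM-sym (fsuc i) (fsuc j) = trans (IM-suc i j) (trans (IM-sym i j) (sym (IM-suc j i)))

sumℤ-IMˡ : ∀ (i : Fin n) (v : Fin n → ℤ) → sumℤ (λ l → IM i l * v l) ≡ v i ⟨mod m ⟩
sumℤ-IMˡ {suc n} fzero v =
  mod-reflexive (trans (cong (_+_ (+ 1 * v fzero)) (sumℤ-zero n))
                       (trans (ℤ.+-identityʳ _) (ℤ.*-identityˡ _)))
sumℤ-IMˡ {suc n} (fsuc i) v = mod-trans
  (mod-reflexive (ℤ.+-identityˡ _))
  (mod-trans (sumℤ-cong (λ l → mod-reflexive (cong (_* v (fsuc l)) (IM-suc i l))))
             (sumℤ-IMˡ i (v ∘ fsuc)))

sumℤ-IMʳ : ∀ (j : Fin n) (v : Fin n → ℤ) → sumℤ (λ l → v l * IM l j) ≡ v j ⟨mod m ⟩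
sumℤ-IMʳ j v = mod-trans
  (sumℤ-cong (λ l → mod-reflexive (trans (ℤ.*-comm (v l) (IM l j)) (cong (_* v l) (IM-sym l j)))))
  (sumℤ-IMˡ j v)

record _≋_⟨mod_⟩ (A B : Mat n) (m : ℕ) : Set where
  constructor entrywise
  field entry : ∀ i j → A i j ≡ B i j ⟨mod m ⟩
open _≋_⟨mod_⟩ public

infix 4 _≋_⟨mod_⟩

≋-reflexive : ∀ {A B : Mat n} → (∀ i j → A i j ≡ B i j) → A ≋ B ⟨mod m ⟩
≋-reflexive e = entrywise λ i j → mod-reflexive (e i j)

≋-refl : ∀ {A : Mat n} → A ≋ A ⟨mod m ⟩
≋-refl = entrywise λ i j → mod-refl

≋-sym : ∀ {A B : Mat n} → A ≋ B ⟨mod m ⟩ → B ≋ A ⟨mod m ⟩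
≋-sym (entrywise e) = entrywise λ i j → mod-sym (e i j)

≋-trans : ∀ {A B C : Mat n} → A ≋ B ⟨mod m ⟩ → B ≋ C ⟨mod m ⟩ → A ≋ C ⟨mod m ⟩
≋-trans (entrywise e) (entrywise f) = entrywise λ i j → mod-trans (e i j) (f i j)

≋-setoid : ℕ → ℕ → Setoid 0ℓ 0ℓ
≋-setoid n m = record
  { Carrier       = Mat n
  ; _≈_           = _≋_⟨mod m ⟩
  ; isEquivalence = record { refl = ≋-refl ; sym = ≋-sym ; trans = ≋-trans }
  }

module ≋-Reasoning {n m : ℕ} where
  open import Relation.Binary.Reasoning.Setoid (≋-setoid n m) public

≋-weaken : ∀ {d} {A B : Mat n} → d ℕ.∣ m → A ≋ B ⟨mod m ⟩ → A ≋ B ⟨mod d ⟩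
≋-weaken d∣m (entrywise e) = entrywise λ i j → mod-weaken d∣m (e i j)

≋-one : ∀ {A B : Mat n} → A ≋ B ⟨mod 1 ⟩
≋-one = entrywise λ i j → mod-one

+M-cong : ∀ {A B C D : Mat n} → A ≋ B ⟨mod m ⟩ → C ≋ D ⟨mod m ⟩ → A +M C ≋ B +M D ⟨mod m ⟩
+M-cong (entrywise e) (entrywise f) = entrywise λ i j → mod-+ (e i j) (f i j)

+M-congˡ : ∀ (A : Mat n) {C D : Mat n} → C ≋ D ⟨mod m ⟩ → A +M C ≋ A +M D ⟨mod m ⟩
+M-congˡ A = +M-cong (≋-refl {A = A})

negM : Mat n → Mat n
negM A i j = - A i j

negM-cong : ∀ {A B : Mat n} → A ≋ B ⟨mod m ⟩ → negM A ≋ negM B ⟨mod m ⟩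
negM-cong (entrywise e) = entrywise λ i j → mod-neg (e i j)

*M-cong : ∀ {A B C D : Mat n} → A ≋ B ⟨mod m ⟩ → C ≋ D ⟨mod m ⟩ → A *M C ≋ B *M D ⟨mod m ⟩
*M-cong (entrywise e) (entrywise f) = entrywise λ i j → sumℤ-cong λ l → mod-* (e i l) (f l j)

*M-congˡ : ∀ (A : Mat n) {C D : Mat n} → C ≋ D ⟨mod m ⟩ → A *M C ≋ A *M D ⟨mod m ⟩
*M-congˡ A = *M-cong (≋-refl {A = A})

·M-cong : ∀ c {A B : Mat n} → A ≋ B ⟨mod m ⟩ → c ·M A ≋ c ·M B ⟨mod m ⟩
·M-cong c (entrywise e) = entrywise λ i j → mod-* (mod-refl {a = c}) (e i j)

·M-scale : ∀ c {A B : Mat n} → A ≋ B ⟨mod m ⟩ → (+ c) ·M A ≋ (+ c) ·M B ⟨mod c ℕ.* m ⟩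
·M-scale c (entrywise e) = entrywise λ i j → mod-scale c (e i j)

·M-multiple : ∀ c (A : Mat n) → (+ c) ·M A ≋ 0M ⟨mod c ⟩
·M-multiple c A = entrywise λ i j → mod-multiple c (A i j)

+M-identityˡ : ∀ (A : Mat n) → 0M +M A ≋ A ⟨mod m ⟩
+M-identityˡ A = ≋-reflexive λ i j → ℤ.+-identityˡ (A i j)

+M-identityʳ : ∀ (A : Mat n) → A +M 0M ≋ A ⟨mod m ⟩
+M-identityʳ A = ≋-reflexive λ i j → ℤ.+-identityʳ (A i j)

+M-assoc : ∀ (A B C : Mat n) → (A +M B) +M C ≋ A +M (B +M C) ⟨mod m ⟩
+M-assoc A B C = ≋-reflexive λ i j → ℤ.+-assoc (A i j) (B i j) (C i j)

+M-comm : ∀ (A B : Mat n) → A +M B ≋ B +M A ⟨mod m ⟩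
+M-comm A B = ≋-reflexive λ i j → ℤ.+-comm (A i j) (B i j)

+M-negM-cancelʳ : ∀ (A B : Mat n) → (A +M B) +M negM B ≋ A ⟨mod m ⟩
+M-negM-cancelʳ A B = ≋-reflexive λ i j → cancel (A i j) (B i j)
  where
  cancel : ∀ a b → (a + b) + - b ≡ a
  cancel = solve-∀

*M-zeroˡ : ∀ (A : Mat n) → 0M *M A ≋ 0M ⟨mod m ⟩
*M-zeroˡ {n} A = ≋-reflexive λ i j → sumℤ-zero n

*M-zeroʳ : ∀ (A : Mat n) → A *M 0M ≋ 0M ⟨mod m ⟩
*M-zeroʳ {n} A = entrywise λ i j →
  mod-trans (sumℤ-cong λ l → mod-reflexive (ℤ.*-zeroʳ (A i l))) (mod-reflexive (sumℤ-zero n))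

*M-identityˡ : ∀ (A : Mat n) → IM *M A ≋ A ⟨mod m ⟩
*M-identityˡ A = entrywise λ i j → sumℤ-IMˡ i (λ l → A l j)

*M-identityʳ : ∀ (A : Mat n) → A *M IM ≋ A ⟨mod m ⟩
*M-identityʳ A = entrywise λ i j → sumℤ-IMʳ j (A i)

·M-*M-assoc : ∀ c (A B : Mat n) → (c ·M A) *M B ≋ c ·M (A *M B) ⟨mod m ⟩
·M-*M-assoc c A B = entrywise λ i j →
  mod-trans (sumℤ-cong λ l → mod-reflexive (ℤ.*-assoc c (A i l) (B l j)))
            (mod-reflexive (sumℤ-*-distribˡ c (λ l → A i l * B l j)))

·M-zeroʳ : ∀ c → c ·M 0M {n} ≋ 0M ⟨mod m ⟩
·M-zeroʳ c = ≋-reflexive λ i j → ℤ.*-zeroʳ c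

+M-cancelʳ : ∀ {A B C D : Mat n} → A +M B ≋ C +M D ⟨mod m ⟩ → B ≋ D ⟨mod m ⟩ → A ≋ C ⟨mod m ⟩
+M-cancelʳ {A = A} {B} {C} {D} e f = begin
  A                    ≈⟨ +M-negM-cancelʳ A B ⟨
  (A +M B) +M negM B   ≈⟨ +M-cong e (negM-cong f) ⟩
  (C +M D) +M negM D   ≈⟨ +M-negM-cancelʳ C D ⟩
  C                    ∎
  where open ≋-Reasoning

+M-cancelˡ : ∀ {A B C D : Mat n} → A +M B ≋ C +M D ⟨mod m ⟩ → A ≋ C ⟨mod m ⟩ → B ≋ D ⟨mod m ⟩
+M-cancelˡ {A = A} {B} {C} {D} e =
  +M-cancelʳ (≋-trans (+M-comm B A) (≋-trans e (+M-comm C D)))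

A+B≋0⇒A≋-B : ∀ {A B : Mat n} → 0M ≋ A +M B ⟨mod m ⟩ → A ≋ negM B ⟨mod m ⟩
A+B≋0⇒A≋-B {B = B} e = +M-cancelʳ (≋-trans (≋-sym e) (-B+B≋0 B)) ≋-refl
  where
  -B+B≋0 : ∀ (B : Mat n) → 0M ≋ negM B +M B ⟨mod m ⟩
  -B+B≋0 B = ≋-reflexive λ i j → sym (ℤ.+-inverseˡ (B i j))

sumM-cong : ∀ k {f g : ℕ → Mat n} → (∀ j → f j ≋ g j ⟨mod m ⟩) → sumM k f ≋ sumM k g ⟨mod m ⟩
sumM-cong zero    e = ≋-refl
sumM-cong (suc k) e = +M-cong (sumM-cong k e) (e k)

sumM-zero : ∀ k → sumM {n} k (λ _ → 0M) ≋ 0M ⟨mod m ⟩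
sumM-zero zero    = ≋-refl
sumM-zero (suc k) = ≋-trans (+M-identityʳ _) (sumM-zero k)

sumM-·M : ∀ k c (f : ℕ → Mat n) → sumM k (λ j → c ·M f j) ≋ c ·M sumM k f ⟨mod m ⟩
sumM-·M zero    c f = ≋-sym (·M-zeroʳ c)
sumM-·M (suc k) c f = ≋-trans (+M-cong (sumM-·M k c f) ≋-refl)
  (≋-reflexive λ i j → sym (ℤ.*-distribˡ-+ c _ _))

sumM-peelˡ : ∀ k (f : ℕ → Mat n) → sumM (suc k) f ≋ f 0 +M sumM k (f ∘ suc) ⟨mod m ⟩
sumM-peelˡ zero    f = ≋-trans (+M-identityˡ (f 0)) (≋-sym (+M-identityʳ (f 0)))
sumM-peelˡ (suc k) f = ≋-trans (+M-cong (sumM-peelˡ k f) ≋-refl)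
  (+M-assoc (f 0) (sumM k (f ∘ suc)) (f (suc k)))

-- Polynomials

_≋ₚ_⟨mod_⟩ : Poly n → Poly n → ℕ → Set
P ≋ₚ Q ⟨mod m ⟩ = ∀ i → coeff P i ≋ coeff Q i ⟨mod m ⟩

infix 4 _≋ₚ_⟨mod_⟩

mulCoeff-congʳ : ∀ (P Q Q′ : Poly n) → Q ≋ₚ Q′ ⟨mod m ⟩ →
  ∀ i → mulCoeff P Q i ≋ mulCoeff P Q′ i ⟨mod m ⟩
mulCoeff-congʳ P Q Q′ e i = sumM-cong (suc i) λ j → *M-congˡ (coeff P j) (e (i ∸ j))

mulCoeff-zero : ∀ (P Q : Poly n) → mulCoeff P Q 0 ≋ coeff P 0 *M coeff Q 0 ⟨mod m ⟩
mulCoeff-zero P Q = +M-identityˡ _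

mulCoeff-∷ : ∀ a (P Q : Poly n) i →
  mulCoeff (a ∷ P) Q (suc i) ≋ (a *M coeff Q (suc i)) +M mulCoeff P Q i ⟨mod m ⟩
mulCoeff-∷ a P Q i = sumM-peelˡ (suc i) (λ j → coeff (a ∷ P) j *M coeff Q (suc i ∸ j))

mulCoeff-[] : ∀ (Q : Poly n) i → mulCoeff [] Q i ≋ 0M ⟨mod m ⟩
mulCoeff-[] Q i = ≋-trans (sumM-cong (suc i) λ j → *M-zeroˡ (coeff Q (i ∸ j))) (sumM-zero (suc i))

coeff-map : ∀ (f : Mat n → Mat n) → f 0M ≋ 0M ⟨mod m ⟩ →
  ∀ P i → coeff (map f P) i ≋ f (coeff P i) ⟨mod m ⟩
coeff-map f f0 []      i       = ≋-sym f0
coeff-map f f0 (a ∷ P) zero    = ≋-refl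
coeff-map f f0 (a ∷ P) (suc i) = coeff-map f f0 P i

mulCoeff-·M : ∀ c (P Q : Poly n) i → mulCoeff (map (c ·M_) P) Q i ≋ c ·M mulCoeff P Q i ⟨mod m ⟩
mulCoeff-·M {m = m} c P Q i = begin
  mulCoeff (map (c ·M_) P) Q i                             ≈⟨ sumM-cong (suc i) scale-first ⟩
  sumM (suc i) (λ j → c ·M (coeff P j *M coeff Q (i ∸ j))) ≈⟨ sumM-·M (suc i) c _ ⟩
  c ·M mulCoeff P Q i                                      ∎
  where
  open ≋-Reasoning
  scale-first : ∀ j → coeff (map (c ·M_) P) j *M coeff Q (i ∸ j)
                        ≋ c ·M (coeff P j *M coeff Q (i ∸ j)) ⟨mod m ⟩
  scale-first j = ≋-trans (*M-cong (coeff-map (c ·M_) (·M-zeroʳ c) P j) ≋-refl)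
                          (·M-*M-assoc c (coeff P j) (coeff Q (i ∸ j)))

_+ₚ_ : Poly n → Poly n → Poly n
[]      +ₚ Q       = Q
(a ∷ P) +ₚ []      = a ∷ P
(a ∷ P) +ₚ (b ∷ Q) = (a +M b) ∷ (P +ₚ Q)

coeff-+ₚ : ∀ (P Q : Poly n) i → coeff (P +ₚ Q) i ≋ coeff P i +M coeff Q i ⟨mod m ⟩
coeff-+ₚ []      Q       i       = ≋-sym (+M-identityˡ _)
coeff-+ₚ (a ∷ P) []      i       = ≋-sym (+M-identityʳ _)
coeff-+ₚ (a ∷ P) (b ∷ Q) zero    = ≋-refl
coeff-+ₚ (a ∷ P) (b ∷ Q) (suc i) = coeff-+ₚ P Q i

_*ₚ_ : Poly n → Poly n → Poly n
[]      *ₚ Q = []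
(a ∷ P) *ₚ Q = map (a *M_) Q +ₚ (0M ∷ P *ₚ Q)

coeff-*ₚ : ∀ (P Q : Poly n) i → coeff (P *ₚ Q) i ≋ mulCoeff P Q i ⟨mod m ⟩
coeff-*ₚ []      Q i       = ≋-sym (mulCoeff-[] Q i)
coeff-*ₚ (a ∷ P) Q zero    = begin
  coeff (map (a *M_) Q +ₚ (0M ∷ P *ₚ Q)) 0  ≈⟨ coeff-+ₚ (map (a *M_) Q) _ 0 ⟩
  coeff (map (a *M_) Q) 0 +M 0M             ≈⟨ +M-identityʳ _ ⟩
  coeff (map (a *M_) Q) 0                   ≈⟨ coeff-map (a *M_) (*M-zeroʳ a) Q 0 ⟩
  a *M coeff Q 0                            ≈⟨ mulCoeff-zero (a ∷ P) Q ⟨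
  mulCoeff (a ∷ P) Q 0                      ∎
  where open ≋-Reasoning
coeff-*ₚ (a ∷ P) Q (suc i) = begin
  coeff (map (a *M_) Q +ₚ (0M ∷ P *ₚ Q)) (suc i)  ≈⟨ coeff-+ₚ (map (a *M_) Q) _ (suc i) ⟩
  coeff (map (a *M_) Q) (suc i) +M coeff (P *ₚ Q) i ≈⟨ +M-cong (coeff-map (a *M_) (*M-zeroʳ a) Q (suc i)) (coeff-*ₚ P Q i) ⟩
  (a *M coeff Q (suc i)) +M mulCoeff P Q i            ≈⟨ mulCoeff-∷ a P Q i ⟨
  mulCoeff (a ∷ P) Q (suc i)                        ∎
  where open ≋-Reasoning

-- Division by X + t

mulXt : Mat n → Poly n → ℕ → Mat n
mulXt X U zero    = X *M coeff U 0
mulXt X U (suc i) = (X *M coeff U (suc i)) +M coeff U i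

-- g = (X + t)·quotXt X g + remXt X g, computed Horner-style from the leading coefficient.
remXt : Mat n → Poly n → Mat n
remXt X []       = 0M
remXt X (g ∷ gs) = g +M negM (X *M remXt X gs)

quotXt : Mat n → Poly n → Poly n
quotXt X []       = []
quotXt X (g ∷ gs) = remXt X gs ∷ quotXt X gs

divXt-identity₀ : ∀ (X : Mat n) g → coeff g 0 ≋ mulXt X (quotXt X g) 0 +M remXt X g ⟨mod m ⟩
divXt-identity₀ X []       = ≋-sym (≋-trans (+M-identityʳ (X *M 0M)) (*M-zeroʳ X))
divXt-identity₀ X (g ∷ gs) = ≋-reflexive λ i j → split (g i j) ((X *M remXt X gs) i j)
  where
  split : ∀ a b → a ≡ b + (a + - b)
  split = solve-∀

divXt-identity : ∀ (X : Mat n) g i → coeff g (suc i) ≋ mulXt X (quotXt X g) (suc i) ⟨mod m ⟩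
divXt-identity X []       i       = ≋-sym (≋-trans (+M-identityʳ (X *M 0M)) (*M-zeroʳ X))
divXt-identity X (g ∷ gs) zero    = divXt-identity₀ X gs
divXt-identity X (g ∷ gs) (suc i) = divXt-identity X gs i

remXt-cong : ∀ (X : Mat n) g g′ → g ≋ₚ g′ ⟨mod m ⟩ → remXt X g ≋ remXt X g′ ⟨mod m ⟩
remXt-cong X []      []       e = ≋-refl
remXt-cong X []      (b ∷ g′) e = ≋-trans (≋-sym (+M-identityʳ 0M))
  (+M-cong (e 0) (negM-cong (≋-trans (≋-sym (*M-zeroʳ X)) (*M-congˡ X (remXt-cong X [] g′ (e ∘ suc))))))
remXt-cong X (a ∷ g) []       e = ≋-trans
  (+M-cong (e 0) (negM-cong (≋-trans (*M-congˡ X (remXt-cong X g [] (e ∘ suc))) (*M-zeroʳ X))))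
  (+M-identityʳ 0M)
remXt-cong X (a ∷ g) (b ∷ g′) e = +M-cong (e 0) (negM-cong (*M-congˡ X (remXt-cong X g g′ (e ∘ suc))))

quotXt-cong : ∀ (X : Mat n) g g′ → g ≋ₚ g′ ⟨mod m ⟩ → quotXt X g ≋ₚ quotXt X g′ ⟨mod m ⟩
quotXt-cong X []      []       e i       = ≋-refl
quotXt-cong X []      (b ∷ g′) e zero    = remXt-cong X [] g′ (e ∘ suc)
quotXt-cong X []      (b ∷ g′) e (suc i) = quotXt-cong X [] g′ (e ∘ suc) i
quotXt-cong X (a ∷ g) []       e zero    = remXt-cong X g [] (e ∘ suc)
quotXt-cong X (a ∷ g) []       e (suc i) = quotXt-cong X g [] (e ∘ suc) i
quotXt-cong X (a ∷ g) (b ∷ g′) e zero    = remXt-cong X g g′ (e ∘ suc)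
quotXt-cong X (a ∷ g) (b ∷ g′) e (suc i) = quotXt-cong X g g′ (e ∘ suc) i

coeff-beyond-length : ∀ (P : Poly n) i → length P ≤ i → coeff P i ≋ 0M ⟨mod m ⟩
coeff-beyond-length []      i       _         = ≋-refl
coeff-beyond-length (a ∷ P) (suc i) (s≤s len) = coeff-beyond-length P i len

-- Descending induction from the degree: the top coefficients agree because both vanish, and
-- X Uᵢ₊₁ + Uᵢ ≡ X U′ᵢ₊₁ + U′ᵢ then passes agreement from index i + 1 down to i.
mulXt-injective : ∀ (X : Mat n) U U′ → (∀ i → mulXt X U (suc i) ≋ mulXt X U′ (suc i) ⟨mod m ⟩) →
  U ≋ₚ U′ ⟨mod m ⟩
mulXt-injective {m = m} X U U′ e i = agree-below B i (ℕ.m≤n+m B i)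
  where
  B : ℕ
  B = length U ℕ.+ length U′
  agree-below : ∀ d i → B ≤ i ℕ.+ d → coeff U i ≋ coeff U′ i ⟨mod m ⟩
  agree-below zero i B≤i = ≋-trans
    (coeff-beyond-length U i (ℕ.≤-trans (ℕ.m≤m+n _ _) B≤i′))
    (≋-sym (coeff-beyond-length U′ i (ℕ.≤-trans (ℕ.m≤n+m _ _) B≤i′)))
    where
    B≤i′ : B ≤ i
    B≤i′ = subst (B ≤_) (ℕ.+-identityʳ i) B≤i
  agree-below (suc d) i B≤i+1+d =
    +M-cancelˡ (e i) (*M-congˡ X (agree-below d (suc i) (subst (B ≤_) (ℕ.+-suc i d) B≤i+1+d)))

module _ (p : ℕ) (X : Mat n) (M U : Poly n) where

  shape-mulCoeff₀ : mulCoeff (shape p X M) U 0 ≋ mulXt X U 0 ⟨mod m ⟩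
  shape-mulCoeff₀ = mulCoeff-zero (shape p X M) U

  shape-mulCoeff₁ : mulCoeff (shape p X M) U 1 ≋ mulXt X U 1 ⟨mod m ⟩
  shape-mulCoeff₁ = ≋-trans (mulCoeff-∷ X (IM ∷ map ((+ p) ·M_) M) U 0)
    (+M-congˡ (X *M coeff U 1) (≋-trans (mulCoeff-zero (IM ∷ map ((+ p) ·M_) M) U) (*M-identityˡ (coeff U 0))))

  shape-mulCoeff₂₊ : ∀ j →
    mulCoeff (shape p X M) U (suc (suc j)) ≋ mulXt X U (suc (suc j)) +M ((+ p) ·M mulCoeff M U j) ⟨mod m ⟩
  shape-mulCoeff₂₊ j = begin
    mulCoeff (shape p X M) U (suc (suc j))
      ≈⟨ mulCoeff-∷ X (IM ∷ map ((+ p) ·M_) M) U (suc j) ⟩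
    (X *M coeff U (suc (suc j))) +M mulCoeff (IM ∷ map ((+ p) ·M_) M) U (suc j)
      ≈⟨ +M-congˡ (X *M coeff U (suc (suc j))) (mulCoeff-∷ IM (map ((+ p) ·M_) M) U j) ⟩
    (X *M coeff U (suc (suc j))) +M ((IM *M coeff U (suc j)) +M mulCoeff (map ((+ p) ·M_) M) U j)
      ≈⟨ +M-congˡ (X *M coeff U (suc (suc j))) (+M-cong (*M-identityˡ (coeff U (suc j))) (mulCoeff-·M (+ p) M U j)) ⟩
    (X *M coeff U (suc (suc j))) +M (coeff U (suc j) +M ((+ p) ·M mulCoeff M U j))
      ≈⟨ +M-assoc (X *M coeff U (suc (suc j))) (coeff U (suc j)) _ ⟨
    mulXt X U (suc (suc j)) +M ((+ p) ·M mulCoeff M U j)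
      ∎
    where open ≋-Reasoning

tPoly : Poly n
tPoly = 0M ∷ IM ∷ []

-- Dividing t by X + t: t = (X + t)·1 − X.
quotXt-t₀ : ∀ (X : Mat n) → coeff (quotXt X tPoly) 0 ≋ IM ⟨mod m ⟩
quotXt-t₀ X = ≋-trans (+M-congˡ IM (negM-cong (*M-zeroʳ X))) (+M-identityʳ IM)

quotXt-t₊ : ∀ (X : Mat n) i → coeff (quotXt X tPoly) (suc i) ≋ 0M ⟨mod m ⟩
quotXt-t₊ X zero    = ≋-refl
quotXt-t₊ X (suc i) = ≋-refl

remXt-t : ∀ (X : Mat n) → negM (remXt X tPoly) ≋ X ⟨mod m ⟩
remXt-t X = begin
  negM (0M +M negM (X *M coeff (quotXt X tPoly) 0))  ≈⟨ ≋-reflexive (λ a b → negate-twice ((X *M coeff (quotXt X tPoly) 0) a b)) ⟩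
  X *M coeff (quotXt X tPoly) 0                      ≈⟨ *M-congˡ X (quotXt-t₀ X) ⟩
  X *M IM                                            ≈⟨ *M-identityʳ X ⟩
  X                                                  ∎
  where
  open ≋-Reasoning
  negate-twice : ∀ a → - (+ 0 + - a) ≡ a
  negate-twice = solve-∀

-- The equation

module Equation (p : ℕ) (X : Mat n) (M N : Poly n) where

  record IsSolution (m : ℕ) (U : Poly n) (X′ : Mat n) : Set where
    constructor isSolution
    field equation : ∀ i → mulCoeff (shape p X M) U i ≋ coeff (shape p X′ N) i ⟨mod m ⟩
  open IsSolution public

  -- Mod p·d, the p t² M(t) terms of both products agree, so (X + t)U₁ and (X + t)U₂ agree
  -- in positive degrees.
  solution-unique-step : ∀ {U₁ U₂ X₁ X₂ d} → p ℕ.* d ℕ.∣ m →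
    IsSolution m U₁ X₁ → IsSolution m U₂ X₂ →
    U₁ ≋ₚ U₂ ⟨mod d ⟩ → U₁ ≋ₚ U₂ ⟨mod p ℕ.* d ⟩
  solution-unique-step {m = m} {U₁} {U₂} {d = d} pd∣m sol₁ sol₂ U₁≋U₂ = mulXt-injective X U₁ U₂ agree
    where
    products-agree : ∀ i → mulCoeff (shape p X M) U₁ (suc i) ≋ mulCoeff (shape p X M) U₂ (suc i) ⟨mod p ℕ.* d ⟩
    products-agree i = ≋-weaken pd∣m (≋-trans (equation sol₁ (suc i)) (≋-sym (equation sol₂ (suc i))))
    agree : ∀ i → mulXt X U₁ (suc i) ≋ mulXt X U₂ (suc i) ⟨mod p ℕ.* d ⟩
    agree zero    = ≋-trans (≋-sym (shape-mulCoeff₁ p X M U₁))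
                      (≋-trans (products-agree 0) (shape-mulCoeff₁ p X M U₂))
    agree (suc j) = +M-cancelʳ
      (≋-trans (≋-sym (shape-mulCoeff₂₊ p X M U₁ j))
        (≋-trans (products-agree (suc j)) (shape-mulCoeff₂₊ p X M U₂ j)))
      (·M-scale p (mulCoeff-congʳ M U₁ U₂ U₁≋U₂ j))

  solution-unique : ∀ {U₁ U₂ X₁ X₂} k → IsSolution (p ^ k) U₁ X₁ → IsSolution (p ^ k) U₂ X₂ →
    U₁ ≋ₚ U₂ ⟨mod p ^ k ⟩ × X₁ ≋ X₂ ⟨mod p ^ k ⟩
  solution-unique {U₁} {U₂} {X₁} {X₂} k sol₁ sol₂ = U₁≋U₂ , X₁≋X₂
    where
    unique-mod : ∀ s → s ≤ k → U₁ ≋ₚ U₂ ⟨mod p ^ s ⟩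
    unique-mod zero    _   i = ≋-one
    unique-mod (suc s) s<k   = solution-unique-step (^-monoʳ-∣ p s<k) sol₁ sol₂
                                 (unique-mod s (ℕ.<⇒≤ s<k))
    U₁≋U₂ : U₁ ≋ₚ U₂ ⟨mod p ^ k ⟩
    U₁≋U₂ = unique-mod k ℕ.≤-refl
    X₁≋X₂ : X₁ ≋ X₂ ⟨mod p ^ k ⟩
    X₁≋X₂ = begin
      X₁                             ≈⟨ equation sol₁ 0 ⟨
      mulCoeff (shape p X M) U₁ 0    ≈⟨ shape-mulCoeff₀ p X M U₁ ⟩
      X *M coeff U₁ 0                ≈⟨ *M-congˡ X (U₁≋U₂ 0) ⟩
      X *M coeff U₂ 0                ≈⟨ shape-mulCoeff₀ p X M U₂ ⟨
      mulCoeff (shape p X M) U₂ 0    ≈⟨ equation sol₂ 0 ⟩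
      X₂                             ∎
      where open ≋-Reasoning

  -- t + p t² (N − M U): a solution U satisfies (X + t) U = X′ + target U.
  target : Poly n → Poly n
  target U = 0M ∷ IM ∷ map ((+ p) ·M_) (N +ₚ map negM (M *ₚ U))

  target-coeff₂₊ : ∀ U j →
    coeff (target U) (suc (suc j)) ≋ (+ p) ·M (coeff N j +M negM (mulCoeff M U j)) ⟨mod m ⟩
  target-coeff₂₊ U j = begin
    coeff (map ((+ p) ·M_) (N +ₚ map negM (M *ₚ U))) j
      ≈⟨ coeff-map ((+ p) ·M_) (·M-zeroʳ (+ p)) (N +ₚ map negM (M *ₚ U)) j ⟩
    (+ p) ·M coeff (N +ₚ map negM (M *ₚ U)) j
      ≈⟨ ·M-cong (+ p) (coeff-+ₚ N _ j) ⟩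
    (+ p) ·M (coeff N j +M coeff (map negM (M *ₚ U)) j)
      ≈⟨ ·M-cong (+ p) (+M-congˡ (coeff N j) (coeff-map negM ≋-refl (M *ₚ U) j)) ⟩
    (+ p) ·M (coeff N j +M negM (coeff (M *ₚ U) j))
      ≈⟨ ·M-cong (+ p) (+M-congˡ (coeff N j) (negM-cong (coeff-*ₚ M U j))) ⟩
    (+ p) ·M (coeff N j +M negM (mulCoeff M U j))
      ∎
    where open ≋-Reasoning

  target-contracts : ∀ {d} U U′ → U ≋ₚ U′ ⟨mod d ⟩ → target U ≋ₚ target U′ ⟨mod p ℕ.* d ⟩
  target-contracts U U′ e zero          = ≋-refl
  target-contracts U U′ e (suc zero)    = ≋-refl
  target-contracts U U′ e (suc (suc j)) = begin
    coeff (target U) (suc (suc j))                  ≈⟨ target-coeff₂₊ U j ⟩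
    (+ p) ·M (coeff N j +M negM (mulCoeff M U j))   ≈⟨ ·M-scale p (+M-congˡ (coeff N j) (negM-cong (mulCoeff-congʳ M U U′ e j))) ⟩
    (+ p) ·M (coeff N j +M negM (mulCoeff M U′ j))  ≈⟨ target-coeff₂₊ U′ j ⟨
    coeff (target U′) (suc (suc j))                 ∎
    where open ≋-Reasoning

  target≋t : ∀ U → target U ≋ₚ tPoly ⟨mod p ⟩
  target≋t U zero          = ≋-refl
  target≋t U (suc zero)    = ≋-refl
  target≋t U (suc (suc j)) = ≋-trans (target-coeff₂₊ U j) (·M-multiple p _)

  approx : ℕ → Poly n
  approx zero    = []
  approx (suc j) = quotXt X (target (approx j))

  approx-converges : ∀ j → approx (suc j) ≋ₚ approx j ⟨mod p ^ j ⟩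
  approx-converges zero    i = ≋-one
  approx-converges (suc j)   = quotXt-cong X (target (approx (suc j))) (target (approx j))
    (target-contracts (approx (suc j)) (approx j) (approx-converges j))

  solution : ℕ → Poly n
  solution k = approx (suc k)

  solution-X′ : ℕ → Mat n
  solution-X′ k = negM (remXt X (target (approx k)))

  solution-equation : ∀ k i →
    mulCoeff (shape p X M) (solution k) i ≋ coeff (shape p (solution-X′ k) N) i ⟨mod p ^ k ⟩
  solution-equation k zero = begin
    mulCoeff (shape p X M) U 0  ≈⟨ shape-mulCoeff₀ p X M U ⟩
    mulXt X U 0                 ≈⟨ A+B≋0⇒A≋-B (divXt-identity₀ X (target V)) ⟩
    solution-X′ k               ∎
    where
    open ≋-Reasoning
    V U : Poly n
    V = approx k
    U = solution k
  solution-equation k (suc zero) =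
    ≋-trans (shape-mulCoeff₁ p X M (solution k)) (≋-sym (divXt-identity X (target (approx k)) 0))
  -- solution k = quotXt X (target V) with V = approx k ≡ solution k mod p^k, so M V may replace M U.
  solution-equation k (suc (suc j)) = begin
    mulCoeff (shape p X M) U (suc (suc j))
      ≈⟨ shape-mulCoeff₂₊ p X M U j ⟩
    mulXt X U (suc (suc j)) +M ((+ p) ·M mulCoeff M U j)
      ≈⟨ +M-cong (≋-sym (divXt-identity X (target V) (suc j)))
                 (·M-cong (+ p) (mulCoeff-congʳ M U V (approx-converges k) j)) ⟩
    coeff (target V) (suc (suc j)) +M ((+ p) ·M mulCoeff M V j)
      ≈⟨ +M-cong (target-coeff₂₊ V j) ≋-refl ⟩
    ((+ p) ·M (coeff N j +M negM (mulCoeff M V j))) +M ((+ p) ·M mulCoeff M V j)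
      ≈⟨ ≋-reflexive (λ a b → cancel (+ p) (coeff N j a b) (mulCoeff M V j a b)) ⟩
    (+ p) ·M coeff N j
      ≈⟨ coeff-map ((+ p) ·M_) (·M-zeroʳ (+ p)) N j ⟨
    coeff (map ((+ p) ·M_) N) j
      ∎
    where
    open ≋-Reasoning
    V U : Poly n
    V = approx k
    U = solution k
    cancel : ∀ c x y → c * (x + - y) + c * y ≡ c * x
    cancel = solve-∀

  solution-solves : ∀ k → IsSolution (p ^ k) (solution k) (solution-X′ k)
  solution-solves k = isSolution (solution-equation k)

  solution≋quotXt-t : ∀ k → solution k ≋ₚ quotXt X tPoly ⟨mod p ⟩
  solution≋quotXt-t k = quotXt-cong X (target (approx k)) tPoly (target≋t (approx k))

  solution-X′≋X : ∀ k → solution-X′ k ≋ X ⟨mod p ⟩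
  solution-X′≋X k = ≋-trans (negM-cong (remXt-cong X (target (approx k)) tPoly (target≋t (approx k))))
                            (remXt-t X)

≋⇒≈M : ∀ {A B : Mat n} → A ≋ B ⟨mod m ⟩ → A ≈M B [mod m ]
≋⇒≈M e i j = quotient , equality
  where open _∣_ (_≡_⟨mod_⟩.difference (entry e i j))

≈M⇒≋ : ∀ {A B : Mat n} → A ≈M B [mod m ] → A ≋ B ⟨mod m ⟩
≈M⇒≋ e = entrywise λ i j → mod-divides (divides (proj₁ (e i j)) (proj₂ (e i j)))

theorem5p7 : (p n k : ℕ) → Prime p → n ≥ 1 → k ≥ 1 →
    (M N : Poly n) → (X : Mat n) →
    Σ (Poly n) (λ U → Σ (Mat n) (λ X′ →
      ProdEq (p ^ k) (shape p X M) U (shape p X′ N)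
      × ((U₂ : Poly n) → (X₂ : Mat n) →
          ProdEq (p ^ k) (shape p X M) U₂ (shape p X₂ N) →
          (U₂ ≈P U [mod p ^ k ]) × (X₂ ≈M X′ [mod p ^ k ]))
      × (coeff U 0 ≈M IM [mod p ])
      × ((i : ℕ) → coeff U (suc i) ≈M 0M [mod p ])
      × (X′ ≈M X [mod p ])))
theorem5p7 p n k _ _ _ M N X =
  solution k , solution-X′ k ,
  (λ i → ≋⇒≈M (equation (solution-solves k) i)) ,
  unique ,
  ≋⇒≈M (≋-trans (solution≋quotXt-t k 0) (quotXt-t₀ X)) ,
  (λ i → ≋⇒≈M (≋-trans (solution≋quotXt-t k (suc i)) (quotXt-t₊ X i))) ,
  ≋⇒≈M (solution-X′≋X k)
  where
  open Equation p X M N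
  unique : (U₂ : Poly n) → (X₂ : Mat n) →
    ProdEq (p ^ k) (shape p X M) U₂ (shape p X₂ N) →
    (U₂ ≈P solution k [mod p ^ k ]) × (X₂ ≈M solution-X′ k [mod p ^ k ])
  unique U₂ X₂ sol₂ = (λ i → ≋⇒≈M (proj₁ agreement i)) , ≋⇒≈M (proj₂ agreement)
    where
    U₂-solves : IsSolution (p ^ k) U₂ X₂
    U₂-solves = isSolution (λ i → ≈M⇒≋ (sol₂ i))
    agreement : U₂ ≋ₚ solution k ⟨mod p ^ k ⟩ × X₂ ≋ solution-X′ k ⟨mod p ^ k ⟩
    agreement = solution-unique k U₂-solves (solution-solves k)
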